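{- Let $k,\ell$ be positive integers with $k\ge2$ and $k\mid\ell$, and let $n\ge1$. Suppose $[a_0,\dots,a_{k-1}]$ is an algebraic $k$-gon modulo $n$ with monodromy group $N\rtimes C_k$. Then there exists an algebraic $\ell$-gon $[c_0,\dots,c_{\ell-1}]$ modulo $n$ with monodromy group $N\rtimes C_\ell$.
   Context: An algebraic $k$-gon modulo $n$ ($k\ge2$) is a $k$-tuple of nonnegative integers $[a_0,\dots,a_{k-1}]$ with $\sum a_i\equiv0\pmod n$ and $\gcd(a_0,\dots,a_{k-1},n)=1$. Its monodromy group is $N\rtimes C_k$, where $N\subseteq(\mathbb{Z}/n\mathbb{Z})^k$ is the additive subgroup generated by the columns of the circulant matrix with $(i,j)$ entry $a_{(i-j)\bmod k}$, and $C_k$ acts on $N$ by cyclic permutation of coordinates. Saying the monodromy group is $A\rtimes C_k$ for an abelian group $A$ means the subgroup $N$ is isomorphic to $A$. -}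

module Defs where

open import Data.Nat using (ℕ; zero; suc; _∸_; NonZero)
open import Data.Nat.Divisibility using (_∣_)
import Data.Nat as ℕ
open import Data.Nat.GCD using (gcd)
open import Data.Nat.DivMod using (_mod_)
open import Data.Integer using (ℤ; +_)
import Data.Integer as ℤ
open import Data.Integer.DivMod using (_%ℕ_)
open import Data.Fin using (Fin; toℕ)
open import Data.Vec using (Vec; lookup; tabulate; zipWith; foldr; sum; toList)
import Data.List as List
open import Data.Product using (Σ; _×_; ∃)
open import Relation.Binary.PropositionalEquality using (_≡_)

subMod : ∀ {k} → Fin k → Fin k → Fin k
subMod {zero} () _
subMod {suc k} i j = (toℕ i ℕ.+ (suc k ∸ toℕ j)) mod (suc k)

gcdAll : ∀ {k} → Vec ℕ k → ℕ → ℕ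
gcdAll a n = List.foldr gcd n (toList a)

IsAlgebraicGon : (k n : ℕ) → Vec ℕ k → Set
IsAlgebraicGon k n a = (n ∣ sum a) × (gcdAll a n ≡ 1)

ZnVec : ℕ → ℕ → Set
ZnVec n k = Vec (Fin n) k

red : (n : ℕ) .{{_ : NonZero n}} → ℤ → Fin n
red n x = (x %ℕ n) mod n

addZn : (n : ℕ) .{{_ : NonZero n}} → Fin n → Fin n → Fin n
addZn n x y = (toℕ x ℕ.+ toℕ y) mod n

addVec : (n : ℕ) .{{_ : NonZero n}} → ∀ {k} → ZnVec n k → ZnVec n k → ZnVec n k
addVec n = zipWith (addZn n)

Σℤ : ∀ {k} → (Fin k → ℤ) → ℤ
Σℤ {k} f = foldr (λ _ → ℤ) ℤ._+_ (+ 0) (tabulate f)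

-- The subgroup N ⊆ (Z/nZ)^k generated by the columns of the circulant matrix
-- with (i,j) entry a_{(i-j) mod k}: exactly the Z-linear combinations of columns.
InMonodromy : (n : ℕ) .{{_ : NonZero n}} → ∀ {k} → Vec ℕ k → ZnVec n k → Set
InMonodromy n {k} a v =
  ∃ λ (coef : Fin k → ℤ) →
    v ≡ tabulate (λ i → red n (Σℤ (λ j → coef j ℤ.* (+ lookup a (subMod i j)))))

record SubgroupIso (n : ℕ) .{{_ : NonZero n}} {k m : ℕ}
                   (P : ZnVec n k → Set) (Q : ZnVec n m → Set) : Set where
  field
    to      : ZnVec n k → ZnVec n m
    from    : ZnVec n m → ZnVec n k
    to-mem   : ∀ x → P x → Q (to x)
    from-mem : ∀ y → Q y → P (from y)
    from-to : ∀ x → P x → from (to x) ≡ x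
    to-from : ∀ y → Q y → to (from y) ≡ y
    to-hom  : ∀ x y → P x → P y → to (addVec n x y) ≡ addVec n (to x) (to y)

-- Repeating a k-gon a cyclically ℓ / k times gives an ℓ-gon c whose circulant matrix has entry
-- a_{(ρi − ρj) mod k} at (i, j), where ρ is reduction modulo k.  So every element of N_c is
-- ρ-periodic, and restriction to the first k coordinates maps N_c isomorphically onto N_a, with
-- inverse the cyclic repetition: restricting the combination of columns of c with coefficients
-- x_j gives the combination of columns of a with the fibre sums of x over ρ, and the repetition
-- of a combination of columns of a with coefficients y is the combination of columns of c with
-- y on the first block and 0 elsewhere.  Repetition keeps the gcd of the entries and multiplies
-- their sum by ℓ / k, so c is again an algebraic ℓ-gon modulo n.
module Submission where

open import Defs
open import Function using (_∘_; const)
open import Data.Nat using (ℕ; zero; suc; _+_; _*_; _∸_; _%_; _/_; _≤_; _<_; s≤s; NonZero)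
open import Data.Nat.Properties using (+-assoc; +-comm; *-comm; m≤m+n; m+n∸n≡m; m∸n+n≡m; m≤n⇒∃[o]m+o≡n)
open import Data.Nat.DivMod
  using (_mod_; m%n<n; m%n≤n; m%n%n≡m%n; m<n⇒m%n≡m; %-distribˡ-+; [m+kn]%n≡m%n; m≡m%n+[m/n]*n;
         m<n*o⇒m/o<n; m∣n⇒o%n%m≡o%m)
open import Data.Nat.Divisibility using (_∣_; divides; ∣-refl; ∣-trans; ∣-antisym; ∣n⇒∣m*n)
open import Data.Nat.GCD using (gcd; gcd[m,n]∣m; gcd[m,n]∣n; gcd-greatest)
open import Data.Nat.Tactic.RingSolver using (solve)
open import Data.Integer using (ℤ; +_)
import Data.Integer as ℤ
import Data.Integer.Properties as ℤ
open import Algebra.Properties.Semiring.Sum ℤ.+-*-semiring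
  using (sum; sum-syntax; sum-cong-≗; ∑-comm; *-distribʳ-sum; sum-replicate-zero)
open import Data.Fin using (Fin; zero; suc; toℕ; _↑ˡ_; _↑ʳ_; splitAt; inject≤; combine; quotient; remainder)
open import Data.Fin.Properties
  using (toℕ<n; toℕ-injective; toℕ-fromℕ<; toℕ-inject≤; toℕ-combine; combine-remQuot; remQuot-combine;
         splitAt-↑ˡ; splitAt-↑ʳ)
open import Data.Vec using (Vec; []; _++_; lookup; tabulate; take; concat; replicate; toList)
import Data.Vec as Vec
open import Data.Vec.Properties
  using (lookup∘tabulate; tabulate∘lookup; tabulate-cong; lookup-concat; lookup-replicate;
         lookup-take-inject≤; take-zipWith; sum-++; toList-++)
open import Data.List using (foldr)
import Data.List as List
open import Data.List.Properties using (foldr-++)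
open import Data.List.Relation.Unary.All using (All; []; _∷_)
open import Data.Product using (Σ; _×_; _,_; proj₁; proj₂)
open import Data.Sum using ([_,_]′)
open import Relation.Binary.PropositionalEquality
  using (_≡_; refl; sym; trans; subst; cong; cong₂; module ≡-Reasoning)
open ≡-Reasoning

toℕ-mod : ∀ m n .{{_ : NonZero n}} → toℕ (m mod n) ≡ m % n
toℕ-mod m n = toℕ-fromℕ< (m%n<n m n)

*-split : ∀ {K V t} s u → V + t ≡ K → (suc s + u) * K ≡ (V + u * K) + (t + s * K)
*-split {V = V} {t} s u refl = solve (V List.∷ t List.∷ s List.∷ u List.∷ List.[])

module _ {K : ℕ} .{{_ : NonZero K}} where

  %-absorbˡ : ∀ m n → (m % K + n) % K ≡ (m + n) % K
  %-absorbˡ m n = begin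
    (m % K + n) % K          ≡⟨ %-distribˡ-+ (m % K) n K ⟩
    (m % K % K + n % K) % K  ≡⟨ cong (λ x → (x + n % K) % K) (m%n%n≡m%n m K) ⟩
    (m % K + n % K) % K      ≡⟨ %-distribˡ-+ m n K ⟨
    (m + n) % K              ∎

  -- With j = t + s K and q = 1 + s + u, the complement q K ∸ j is (K ∸ t) + u K.
  ∸-multiple-% : ∀ q {j} x → j < q * K → (x + (q * K ∸ j)) % K ≡ (x + (K ∸ j % K)) % K
  ∸-multiple-% q {j} x j<qK = begin
      (x + (q * K ∸ j)) % K      ≡⟨ cong (λ y → (x + y) % K) complement ⟩
      (x + (K ∸ t + u * K)) % K  ≡⟨ cong (_% K) (+-assoc x (K ∸ t) (u * K)) ⟨
      (x + (K ∸ t) + u * K) % K  ≡⟨ [m+kn]%n≡m%n (x + (K ∸ t)) u K ⟩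
      (x + (K ∸ t)) % K          ∎
    where
    t = j % K
    s = j / K
    s<q = m<n*o⇒m/o<n {j} {q} {K} j<qK
    u = proj₁ (m≤n⇒∃[o]m+o≡n s<q)
    complement : q * K ∸ j ≡ K ∸ t + u * K
    complement = begin
      q * K ∸ j                          ≡⟨ cong (λ p → p * K ∸ j) (proj₂ (m≤n⇒∃[o]m+o≡n s<q)) ⟨
      (suc s + u) * K ∸ j                ≡⟨ cong (_∸ j) (*-split {V = K ∸ t} s u (m∸n+n≡m (m%n≤n j K))) ⟩
      (K ∸ t + u * K) + (t + s * K) ∸ j  ≡⟨ cong (λ y → (K ∸ t + u * K) + y ∸ j) (m≡m%n+[m/n]*n j K) ⟨
      (K ∸ t + u * K) + j ∸ j            ≡⟨ m+n∸n≡m (K ∸ t + u * K) j ⟩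
      K ∸ t + u * K                      ∎

  toℕ-remainder : ∀ {q} (i : Fin (q * K)) → toℕ (remainder {q} K i) ≡ toℕ i % K
  toℕ-remainder {q} i = begin
      toℕ r                    ≡⟨ m<n⇒m%n≡m (toℕ<n r) ⟨
      toℕ r % K                ≡⟨ [m+kn]%n≡m%n (toℕ r) (toℕ b) K ⟨
      (toℕ r + toℕ b * K) % K  ≡⟨ cong (_% K) decomposition ⟩
      toℕ i % K                ∎
    where
    b = quotient {q} K i
    r = remainder {q} K i
    decomposition : toℕ r + toℕ b * K ≡ toℕ i
    decomposition = begin
      toℕ r + toℕ b * K  ≡⟨ trans (+-comm (toℕ r) _) (cong (_+ toℕ r) (*-comm (toℕ b) K)) ⟩
      K * toℕ b + toℕ r  ≡⟨ toℕ-combine b r ⟨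
      toℕ (combine b r)  ≡⟨ cong toℕ (combine-remQuot {q} K i) ⟩
      toℕ i              ∎

  remainder-inject≤ : ∀ {q} (i : Fin K) .(K≤qK : K ≤ q * K) → remainder {q} K (inject≤ i K≤qK) ≡ i
  remainder-inject≤ {q} i K≤qK = toℕ-injective (begin
    toℕ (remainder {q} K (inject≤ i K≤qK))  ≡⟨ toℕ-remainder {q} (inject≤ i K≤qK) ⟩
    toℕ (inject≤ i K≤qK) % K                ≡⟨ cong (_% K) (toℕ-inject≤ i K≤qK) ⟩
    toℕ i % K                               ≡⟨ m<n⇒m%n≡m (toℕ<n i) ⟩
    toℕ i                                   ∎)

remainder-combine : ∀ {q K} (b : Fin q) (r : Fin K) → remainder {q} K (combine b r) ≡ r
remainder-combine b r = cong proj₂ (remQuot-combine b r)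

remainder-subMod : ∀ {k q} (i j : Fin (suc q * suc k)) →
                   remainder {suc q} (suc k) (subMod i j) ≡
                   subMod (remainder {suc q} (suc k) i) (remainder {suc q} (suc k) j)
remainder-subMod {k} {q} i j = toℕ-injective (begin
    toℕ (ρ (subMod i j))                 ≡⟨ toℕ-remainder {q = suc q} (subMod i j) ⟩
    toℕ (subMod i j) % K                 ≡⟨ cong (_% K) (toℕ-mod (toℕ i + (L ∸ toℕ j)) L) ⟩
    (toℕ i + (L ∸ toℕ j)) % L % K        ≡⟨ m∣n⇒o%n%m≡o%m K L (toℕ i + (L ∸ toℕ j)) (divides (suc q) refl) ⟩
    (toℕ i + (L ∸ toℕ j)) % K            ≡⟨ ∸-multiple-% (suc q) (toℕ i) (toℕ<n j) ⟩
    (toℕ i + (K ∸ toℕ j % K)) % K        ≡⟨ %-absorbˡ (toℕ i) (K ∸ toℕ j % K) ⟨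
    (toℕ i % K + (K ∸ toℕ j % K)) % K    ≡⟨ cong₂ (λ x y → (x + (K ∸ y)) % K)
                                              (toℕ-remainder {q = suc q} i) (toℕ-remainder {q = suc q} j) ⟨
    (toℕ (ρ i) + (K ∸ toℕ (ρ j))) % K    ≡⟨ toℕ-mod (toℕ (ρ i) + (K ∸ toℕ (ρ j))) K ⟨
    toℕ (subMod (ρ i) (ρ j))             ∎)
  where
  K = suc k
  L = suc q * K
  ρ : Fin L → Fin K
  ρ = remainder {suc q} K

lookup-extensionality : ∀ {a} {A : Set a} {m} {xs ys : Vec A m} →
                        (∀ i → lookup xs i ≡ lookup ys i) → xs ≡ ys
lookup-extensionality {xs = xs} {ys} eq =
  trans (sym (tabulate∘lookup xs)) (trans (tabulate-cong eq) (tabulate∘lookup ys))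

cycle : ∀ {a} {A : Set a} {K} q → Vec A K → Vec A (q * K)
cycle q xs = concat (replicate q xs)

module _ {a} {A : Set a} where

  lookup-cycle : ∀ {q K} (xs : Vec A K) (i : Fin (q * K)) → lookup (cycle q xs) i ≡ lookup xs (remainder {q} K i)
  lookup-cycle {q} {K} xs i = begin
    lookup (cycle q xs) i                           ≡⟨ cong (lookup (cycle q xs)) (combine-remQuot {q} K i) ⟨
    lookup (cycle q xs) (combine b r)               ≡⟨ lookup-concat (replicate q xs) b r ⟩
    lookup (lookup (replicate q xs) b) r            ≡⟨ cong (λ ys → lookup ys r) (lookup-replicate b xs) ⟩
    lookup xs r                                     ∎
    where
    b = quotient {q} K i
    r = remainder {q} K i

  take-cycle : ∀ {K} .{{_ : NonZero K}} q (xs : Vec A K) → take K (cycle (suc q) xs) ≡ xs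
  take-cycle {K} q xs = lookup-extensionality λ i → begin
    lookup (take K (cycle (suc q) xs)) i           ≡⟨ lookup-take-inject≤ (cycle (suc q) xs) i ⟩
    lookup (cycle (suc q) xs) (inject≤ i _)        ≡⟨ lookup-cycle xs _ ⟩
    lookup xs (remainder {suc q} K (inject≤ i _))  ≡⟨ cong (lookup xs) (remainder-inject≤ {q = suc q} i _) ⟩
    lookup xs i                                    ∎

sum-cycle : ∀ {K} q (xs : Vec ℕ K) → Vec.sum (cycle q xs) ≡ q * Vec.sum xs
sum-cycle zero xs = refl
sum-cycle (suc q) xs = trans (sum-++ xs) (cong (_+_ (Vec.sum xs)) (sum-cycle q xs))

foldr-gcd-∣ : ∀ xs {d m} → d ∣ foldr gcd m xs → All (d ∣_) xs × d ∣ m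
foldr-gcd-∣ List.[] d∣m = [] , d∣m
foldr-gcd-∣ (x List.∷ xs) d∣g =
  let (d∣xs , d∣m) = foldr-gcd-∣ xs (∣-trans d∣g (gcd[m,n]∣n x _)) in
  ∣-trans d∣g (gcd[m,n]∣m x _) ∷ d∣xs , d∣m

foldr-gcd-greatest : ∀ {xs d m} → All (d ∣_) xs → d ∣ m → d ∣ foldr gcd m xs
foldr-gcd-greatest [] d∣m = d∣m
foldr-gcd-greatest (d∣x ∷ d∣xs) d∣m = gcd-greatest d∣x (foldr-gcd-greatest d∣xs d∣m)

foldr-gcd-idem : ∀ xs m → foldr gcd (foldr gcd m xs) xs ≡ foldr gcd m xs
foldr-gcd-idem xs m = ∣-antisym
  (proj₂ (foldr-gcd-∣ xs ∣-refl))
  (foldr-gcd-greatest (proj₁ (foldr-gcd-∣ xs ∣-refl)) ∣-refl)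

gcdAll-++ : ∀ {K M} (xs : Vec ℕ K) (ys : Vec ℕ M) n → gcdAll (xs ++ ys) n ≡ foldr gcd (gcdAll ys n) (toList xs)
gcdAll-++ xs ys n = trans (cong (foldr gcd n) (toList-++ xs ys)) (foldr-++ gcd n (toList xs) (toList ys))

gcdAll-cycle : ∀ {K} q (xs : Vec ℕ K) n → gcdAll (cycle (suc q) xs) n ≡ gcdAll xs n
gcdAll-cycle zero xs n = gcdAll-++ xs [] n
gcdAll-cycle (suc q) xs n = begin
  gcdAll (xs ++ cycle (suc q) xs) n                    ≡⟨ gcdAll-++ xs (cycle (suc q) xs) n ⟩
  foldr gcd (gcdAll (cycle (suc q) xs) n) (toList xs)  ≡⟨ cong (λ m → foldr gcd m (toList xs)) (gcdAll-cycle q xs n) ⟩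
  foldr gcd (gcdAll xs n) (toList xs)                  ≡⟨ foldr-gcd-idem (toList xs) n ⟩
  gcdAll xs n                                          ∎

isAlgebraicGon-cycle : ∀ {K n} q (xs : Vec ℕ K) → IsAlgebraicGon K n xs →
                       IsAlgebraicGon (suc q * K) n (cycle (suc q) xs)
isAlgebraicGon-cycle {n = n} q xs (n∣sum , gcd≡1) =
  subst (n ∣_) (sym (sum-cycle (suc q) xs)) (∣n⇒∣m*n (suc q) n∣sum) ,
  trans (gcdAll-cycle q xs n) gcd≡1

Σℤ≡∑ : ∀ {m} (f : Fin m → ℤ) → Σℤ f ≡ ∑[ i < m ] f i
Σℤ≡∑ {zero} f = refl
Σℤ≡∑ {suc m} f = cong (ℤ._+_ (f zero)) (Σℤ≡∑ (f ∘ suc))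

Σℤ-cong : ∀ {m} {f g : Fin m → ℤ} → (∀ i → f i ≡ g i) → Σℤ f ≡ Σℤ g
Σℤ-cong {m} {f} {g} f≗g = trans (Σℤ≡∑ f) (trans (sum-cong-≗ {m} f≗g) (sym (Σℤ≡∑ g)))

∑-↑ : ∀ m {p} (f : Fin (m + p) → ℤ) → ∑[ i < m + p ] f i ≡ ∑[ i < m ] f (i ↑ˡ p) ℤ.+ ∑[ i < p ] f (m ↑ʳ i)
∑-↑ zero f = sym (ℤ.+-identityˡ _)
∑-↑ (suc m) f = trans (cong (ℤ._+_ (f zero)) (∑-↑ m (f ∘ suc))) (sym (ℤ.+-assoc (f zero) _ _))

∑-combine : ∀ q {K} (f : Fin (q * K) → ℤ) → ∑[ i < q * K ] f i ≡ ∑[ b < q ] ∑[ r < K ] f (combine b r)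
∑-combine zero f = refl
∑-combine (suc q) {K} f = trans (∑-↑ K f) (cong (ℤ._+_ (∑[ r < K ] f (r ↑ˡ q * K))) (∑-combine q (f ∘ (K ↑ʳ_))))

fibreSum : ∀ {q K} → (Fin (q * K) → ℤ) → Fin K → ℤ
fibreSum {q} x r = ∑[ b < q ] x (combine b r)

∑-remainder : ∀ q {K} (x : Fin (q * K) → ℤ) (h : Fin K → ℤ) →
              ∑[ j < q * K ] (x j ℤ.* h (remainder {q} K j)) ≡ ∑[ r < K ] (fibreSum {q} x r ℤ.* h r)
∑-remainder q {K} x h = begin
  ∑[ j < q * K ] (x j ℤ.* h (remainder {q} K j))
    ≡⟨ ∑-combine q _ ⟩
  ∑[ b < q ] ∑[ r < K ] (x (combine b r) ℤ.* h (remainder {q} K (combine b r)))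
    ≡⟨ sum-cong-≗ {q} (λ b → sum-cong-≗ {K} (λ r → cong (λ r' → x (combine b r) ℤ.* h r') (remainder-combine b r))) ⟩
  ∑[ b < q ] ∑[ r < K ] (x (combine b r) ℤ.* h r)
    ≡⟨ ∑-comm {q} {K} (λ b r → x (combine b r) ℤ.* h r) ⟩
  ∑[ r < K ] ∑[ b < q ] (x (combine b r) ℤ.* h r)
    ≡⟨ sum-cong-≗ {K} (λ r → *-distribʳ-sum {q} (h r) (λ b → x (combine b r))) ⟨
  ∑[ r < K ] (fibreSum {q} x r ℤ.* h r)
    ∎

padZero : ∀ {K} q → (Fin K → ℤ) → Fin (suc q * K) → ℤ
padZero {K} q y = [ y , const (+ 0) ]′ ∘ splitAt K

fibreSum-padZero : ∀ {K} q (y : Fin K → ℤ) (r : Fin K) → fibreSum {suc q} (padZero q y) r ≡ y r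
fibreSum-padZero {K} q y r = begin
  padZero q y (r ↑ˡ q * K) ℤ.+ ∑[ b < q ] padZero q y (K ↑ʳ combine b r)
    ≡⟨ cong₂ ℤ._+_ (cong [ y , const (+ 0) ]′ (splitAt-↑ˡ K r (q * K))) padding-vanishes ⟩
  y r ℤ.+ + 0
    ≡⟨ ℤ.+-identityʳ (y r) ⟩
  y r
    ∎
  where
  padding-vanishes : ∑[ b < q ] padZero q y (K ↑ʳ combine b r) ≡ + 0
  padding-vanishes = trans
    (sum-cong-≗ {q} (λ b → cong [ y , const (+ 0) ]′ (splitAt-↑ʳ K (q * K) (combine b r))))
    (sum-replicate-zero q)

columnCombination : (n : ℕ) .{{_ : NonZero n}} → ∀ {m} → Vec ℕ m → (Fin m → ℤ) → ZnVec n m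
columnCombination n c x = tabulate (λ i → red n (Σℤ (λ j → x j ℤ.* + lookup c (subMod i j))))

module CycledGon (k q n : ℕ) .{{_ : NonZero n}} (a : Vec ℕ (suc k)) where

  K = suc k
  L = suc q * K

  ρ : Fin L → Fin K
  ρ = remainder {suc q} K

  c : Vec ℕ L
  c = cycle (suc q) a

  circulant : Fin K → Fin K → ℤ
  circulant i j = + lookup a (subMod i j)

  row : (Fin L → ℤ) → Fin K → Fin n
  row x r = red n (∑[ j < L ] (x j ℤ.* circulant r (ρ j)))

  lookup-columnCombination : ∀ x i → lookup (columnCombination n c x) i ≡ row x (ρ i)
  lookup-columnCombination x i = begin
    lookup (columnCombination n c x) i                   ≡⟨ lookup∘tabulate (λ i → red n (Σℤ (entry i))) i ⟩
    red n (Σℤ (entry i))                                 ≡⟨ cong (red n) (Σℤ≡∑ (entry i)) ⟩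
    red n (∑[ j < L ] (x j ℤ.* + lookup c (subMod i j)))  ≡⟨ cong (red n) (sum-cong-≗ {L} λ j →
                                                              cong (λ e → x j ℤ.* + e) (circulant-cycle j)) ⟩
    row x (ρ i)                                          ∎
    where
    entry : Fin L → Fin L → ℤ
    entry i j = x j ℤ.* + lookup c (subMod i j)
    circulant-cycle : ∀ j → lookup c (subMod i j) ≡ lookup a (subMod (ρ i) (ρ j))
    circulant-cycle j = trans (lookup-cycle {q = suc q} a (subMod i j)) (cong (lookup a) (remainder-subMod {k} {q} i j))

  lookup-take-columnCombination : ∀ x r → lookup (take K (columnCombination n c x)) r ≡ row x r
  lookup-take-columnCombination x r = begin
    lookup (take K (columnCombination n c x)) r       ≡⟨ lookup-take-inject≤ (columnCombination n c x) r ⟩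
    lookup (columnCombination n c x) (inject≤ r K≤L)  ≡⟨ lookup-columnCombination x (inject≤ r K≤L) ⟩
    row x (ρ (inject≤ r K≤L))                         ≡⟨ cong (row x) (remainder-inject≤ {q = suc q} r K≤L) ⟩
    row x r                                           ∎
    where K≤L = m≤m+n K (q * K)

  row≡columnCombination : ∀ x r → row x r ≡ lookup (columnCombination n a (fibreSum {suc q} x)) r
  row≡columnCombination x r = begin
    row x r                                                      ≡⟨ cong (red n) (∑-remainder (suc q) x (circulant r)) ⟩
    red n (∑[ r' < K ] (fibreSum {suc q} x r' ℤ.* circulant r r'))  ≡⟨ cong (red n) (Σℤ≡∑ (entry r)) ⟨
    red n (Σℤ (entry r))                                         ≡⟨ lookup∘tabulate (λ i → red n (Σℤ (entry i))) r ⟨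
    lookup (columnCombination n a (fibreSum {suc q} x)) r        ∎
    where
    entry : Fin K → Fin K → ℤ
    entry i r' = fibreSum {suc q} x r' ℤ.* circulant i r'

  take-columnCombination : ∀ x → take K (columnCombination n c x) ≡ columnCombination n a (fibreSum {suc q} x)
  take-columnCombination x = lookup-extensionality λ r →
    trans (lookup-take-columnCombination x r) (row≡columnCombination x r)

  cycle-take-columnCombination : ∀ x → cycle (suc q) (take K (columnCombination n c x)) ≡ columnCombination n c x
  cycle-take-columnCombination x = lookup-extensionality λ i → begin
    lookup (cycle (suc q) (take K (columnCombination n c x))) i  ≡⟨ lookup-cycle {q = suc q} (take K (columnCombination n c x)) i ⟩
    lookup (take K (columnCombination n c x)) (ρ i)              ≡⟨ lookup-take-columnCombination x (ρ i) ⟩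
    row x (ρ i)                                                  ≡⟨ lookup-columnCombination x i ⟨
    lookup (columnCombination n c x) i                           ∎

  cycle-columnCombination : ∀ y → cycle (suc q) (columnCombination n a y) ≡ columnCombination n c (padZero q y)
  cycle-columnCombination y = lookup-extensionality λ i → begin
    lookup (cycle (suc q) (columnCombination n a y)) i                      ≡⟨ lookup-cycle {q = suc q} (columnCombination n a y) i ⟩
    lookup (columnCombination n a y) (ρ i)                                  ≡⟨ cong (λ v → lookup v (ρ i)) padded ⟩
    lookup (columnCombination n a (fibreSum {suc q} (padZero q y))) (ρ i)  ≡⟨ row≡columnCombination (padZero q y) (ρ i) ⟨
    row (padZero q y) (ρ i)                                                 ≡⟨ lookup-columnCombination (padZero q y) i ⟨
    lookup (columnCombination n c (padZero q y)) i                          ∎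
    where
    padded : columnCombination n a y ≡ columnCombination n a (fibreSum {suc q} (padZero q y))
    padded = tabulate-cong λ r → cong (red n) (Σℤ-cong λ r' →
      cong (ℤ._* circulant r r') (sym (fibreSum-padZero q y r')))

  cycleIso : SubgroupIso n (InMonodromy n c) (InMonodromy n a)
  cycleIso = record
    { to       = take K
    ; from     = cycle (suc q)
    ; to-mem   = λ { _ (x , refl) → fibreSum {suc q} x , take-columnCombination x }
    ; from-mem = λ { _ (y , refl) → padZero q y , cycle-columnCombination y }
    ; from-to  = λ { _ (x , refl) → cycle-take-columnCombination x }
    ; to-from  = λ y _ → take-cycle q y
    ; to-hom   = λ x y _ _ → take-zipWith (addZn n) x y
    }

proposition5 : (k ℓ n : ℕ) → 2 ≤ k → 1 ≤ ℓ → k ∣ ℓ → .{{_ : NonZero n}} →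
               (a : Vec ℕ k) → IsAlgebraicGon k n a →
               Σ (Vec ℕ ℓ) (λ c → IsAlgebraicGon ℓ n c ×
                 SubgroupIso n (InMonodromy n c) (InMonodromy n a))
proposition5 (suc k) _ n (s≤s _) _ (divides (suc q) refl) a gon =
  cycle (suc q) a , isAlgebraicGon-cycle q a gon , CycledGon.cycleIso k q n a
proposition5 (suc k) _ n (s≤s _) () (divides zero refl) a gon
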